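{- Let $p$ be a prime and $k \ge 1$ an integer. The Eccentric Connectivity index of the divisor prime graph $G_{Dp(p^k)}$ equals $3k$ if $k \ge 2$, and equals $2$ if $k = 1$.
   Context: For a positive integer $n$, the divisor prime graph $G_{Dp(n)}$ is the simple graph whose vertex set is the set of positive divisors of $n$, in which two distinct vertices $x, y$ are adjacent if and only if $\gcd(x,y) = 1$ (no loops). For a connected graph $G$ with degree function $d(\cdot)$ and shortest-path distance $d(u,v)$, the eccentricity of $v$ is $\varepsilon(v) = \max_{u \in V(G)} d(v,u)$, and the Eccentric Connectivity index is $\xi^c(G) = \sum_{v \in V(G)} d(v)\varepsilon(v)$. -}

module Defs where

open import Data.Nat using (ℕ; zero; suc; _+_; _*_; _⊔_)
open import Data.Nat.Properties using (_≟_)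
open import Data.Nat.Divisibility using (_∣?_)
open import Data.Nat.GCD using (gcd)
open import Data.Bool using (Bool; true; false; _∧_; _∨_; not; T; T?)
open import Data.List.Relation.Unary.All using (All)
open import Data.List using (List; []; _∷_; map; filter; length; upTo; foldr)
open import Data.Bool.ListAction using (any)
open import Data.Nat.ListAction using (sum)
open import Relation.Nullary.Decidable using (⌊_⌋)

-- Finite simple graphs with vertices from ℕ, given by a vertex list
-- (without repetitions) and a Boolean (decidable) adjacency relation.

record Graph : Set where
  field
    vertices : List ℕ
    adj      : ℕ → ℕ → Bool

open Graph public

degree : Graph → ℕ → ℕ
degree G v = length (filter (λ u → T? (adj G v u)) (vertices G))

elem : ℕ → List ℕ → Bool
elem x xs = any (λ y → ⌊ x ≟ y ⌋) xs

-- ball G t v : the vertices u with shortest-path distance d(v,u) ≤ t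
-- (breadth-first layers: distance 0 is v itself; distance ≤ t+1 means
-- distance ≤ t or adjacent to some vertex at distance ≤ t).
ball : Graph → ℕ → ℕ → List ℕ
ball G zero    v = v ∷ []
ball G (suc t) v = filter (λ u → T? (elem u (ball G t v) ∨ any (λ w → adj G w u) (ball G t v))) (vertices G)

-- least t ≤ bound with u ∈ ball G t v (returns bound if none found)
searchDist : Graph → ℕ → ℕ → ℕ → ℕ → ℕ
searchDist G v u t zero = t
searchDist G v u t (suc fuel) with elem u (ball G t v)
... | true  = t
... | false = searchDist G v u (suc t) fuel

-- shortest-path distance d(v,u) in a connected graph (any walk between
-- two vertices of a finite graph has a shortest version of length < |V|,
-- so searching t = 0 .. |V| finds it)
dist : Graph → ℕ → ℕ → ℕ
dist G v u = searchDist G v u 0 (length (vertices G))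

ecc : Graph → ℕ → ℕ
ecc G v = foldr (λ u m → dist G v u ⊔ m) 0 (vertices G)

eccConn : Graph → ℕ
eccConn G = sum (map (λ v → degree G v * ecc G v) (vertices G))

Connected : Graph → Set
Connected G = All (λ v → All (λ u → T (elem u (ball G (length (vertices G)) v))) (vertices G)) (vertices G)

divisors : ℕ → List ℕ
divisors n = filter (λ d → d ∣? n) (map suc (upTo n))

divisorPrimeGraph : ℕ → Graph
divisorPrimeGraph n = record
  { vertices = divisors n
  ; adj      = λ x y → not ⌊ x ≟ y ⌋ ∧ ⌊ gcd x y ≟ 1 ⌋
  }

module Submission where

-- The divisors of p ^ k are 1, p, …, p ^ k. The divisor 1 is coprime to all the others, while any
-- two of p, …, p ^ k share the factor p, so the divisor prime graph is the star K₁,ₖ with centre 1.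
-- In a star with k ≥ 2 leaves the centre has degree k and eccentricity 1 and every leaf has degree 1
-- and eccentricity 2, giving k + 2k; the star K₁,₁ has two vertices of degree and eccentricity 1.

open import Defs
open import Data.Bool using (T; T?; _∨_; not; true; false)
open import Data.Bool.ListAction using (any)
open import Data.Bool.Properties using (T-∧; T-∨)
open import Data.List using (List; []; _∷_; map; filter; length; foldr; applyUpTo; upTo)
open import Data.List.Properties
  using (filter-all; filter-none; filter-accept; filter-reject; length-applyUpTo)
open import Data.List.Membership.Propositional using (_∈_; _∉_; lose)
open import Data.List.Membership.Propositional.Properties
  using (∈-filter⁺; ∈-filter⁻; ∈-map⁺; ∈-upTo⁺; ∈-applyUpTo⁺; ∈-applyUpTo⁻; ∈-length)
open import Data.List.Relation.Binary.Subset.Propositional using (_⊆_)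
open import Data.List.Relation.Unary.All as All using (All; []; _∷_)
open import Data.List.Relation.Unary.AllPairs as AllPairs using (AllPairs; []; _∷_)
import Data.List.Relation.Unary.AllPairs.Properties as AllPairsₚ
open import Data.List.Relation.Unary.Any as Any using (Any; here; there)
open import Data.List.Relation.Unary.Any.Properties using (any⁺; any⁻; singleton⁻)
open import Data.List.Relation.Unary.Unique.Propositional using (Unique)
open import Data.Nat
  using (ℕ; zero; suc; _+_; _*_; _^_; _⊔_; _≤_; _<_; _≥_; _≤′_; ≤′-refl; ≤′-step; z≤n; s≤s; NonZero; ≢-nonZero⁻¹; nonTrivial⇒n>1)
open import Data.Nat.Properties
open import Data.Nat.Divisibility
open import Data.Nat.Coprimality as Coprimality
  using (Coprime; coprime-divisor; coprime⇒gcd≡1; gcd≡1⇒coprime; 1-coprimeTo)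
open import Data.Nat.GCD using (gcd)
open import Data.Nat.ListAction using (sum)
open import Data.Nat.Primality using (Prime; prime⇒irreducible; prime⇒nonZero; prime⇒nonTrivial; ¬prime[1])
open import Data.Product using (_×_; _,_; ∃-syntax; proj₁; proj₂)
open import Data.Sum as Sum using (_⊎_; inj₁; inj₂; [_,_])
open import Function using (_∘_; id; Equivalence)
open import Relation.Nullary using (¬_; Dec; yes; no; contradiction)
open import Relation.Nullary.Decidable using (⌊_⌋; fromWitness; toWitness; fromWitnessFalse; toWitnessFalse)
open import Relation.Binary.PropositionalEquality hiding ([_])

elem-complete : ∀ {u xs} → u ∈ xs → T (elem u xs)
elem-complete = any⁺ _ ∘ Any.map fromWitness

elem-sound : ∀ {u} xs → T (elem u xs) → u ∈ xs
elem-sound xs = Any.map toWitness ∘ any⁻ _ xs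

head-≤-∈ : ∀ {x y ys} → All (y <_) ys → x ∈ y ∷ ys → y ≤ x
head-≤-∈ _    (here refl) = ≤-refl
head-≤-∈ y<ys (there x∈)  = <⇒≤ (All.lookup y<ys x∈)

⊆-drop-head : ∀ {x xs ys} → All (x <_) xs → x ∷ xs ⊆ x ∷ ys → xs ⊆ ys
⊆-drop-head x<xs sub z∈ with sub (there z∈)
... | here refl  = contradiction (All.lookup x<xs z∈) (<-irrefl refl)
... | there z∈ys = z∈ys

strictlyIncreasing-≡ : ∀ {xs ys : List ℕ} → AllPairs _<_ xs → AllPairs _<_ ys →
                       xs ⊆ ys → ys ⊆ xs → xs ≡ ys
strictlyIncreasing-≡ []           []           _   _   = refl
strictlyIncreasing-≡ []           (_ ∷ _)      _   ys⊆ with () ← ys⊆ (here refl)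
strictlyIncreasing-≡ (_ ∷ _)      []           xs⊆ _   with () ← xs⊆ (here refl)
strictlyIncreasing-≡ (x<xs ∷ xs↗) (y<ys ∷ ys↗) xs⊆ ys⊆
  with refl ← ≤-antisym (head-≤-∈ x<xs (ys⊆ (here refl))) (head-≤-∈ y<ys (xs⊆ (here refl)))
  = cong (_ ∷_) (strictlyIncreasing-≡ xs↗ ys↗ (⊆-drop-head x<xs xs⊆) (⊆-drop-head y<ys ys⊆))

∃-other-member : ∀ {xs : List ℕ} → Unique xs → 2 ≤ length xs → ∀ x → ∃[ y ] y ∈ xs × y ≢ x
∃-other-member {a ∷ b ∷ _} ((a≢b ∷ _) ∷ _) (s≤s (s≤s _)) x with a ≟ x
... | yes refl = b , there (here refl) , a≢b ∘ sym
... | no a≢x   = a , here refl , a≢x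

sum-map-const : ∀ (f : ℕ → ℕ) {c} xs → All (λ x → f x ≡ c) xs → sum (map f xs) ≡ length xs * c
sum-map-const f []       []         = refl
sum-map-const f (_ ∷ xs) (fx≡c ∷ h) = cong₂ _+_ fx≡c (sum-map-const f xs h)

foldr-⊔-lub : ∀ (f : ℕ → ℕ) {c} xs → All (λ x → f x ≤ c) xs → foldr (λ x m → f x ⊔ m) 0 xs ≤ c
foldr-⊔-lub f []       []         = z≤n
foldr-⊔-lub f (_ ∷ xs) (fx≤c ∷ h) = ⊔-lub fx≤c (foldr-⊔-lub f xs h)

foldr-⊔-upper : ∀ (f : ℕ → ℕ) {x xs} → x ∈ xs → f x ≤ foldr (λ y m → f y ⊔ m) 0 xs
foldr-⊔-upper f (here refl) = m≤m⊔n _ _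
foldr-⊔-upper f (there x∈)  = ≤-trans (foldr-⊔-upper f x∈) (m≤n⊔m _ _)

module _ {G : Graph} {v : ℕ} where

  ∈-ball-zero⁻ : ∀ {u} → u ∈ ball G 0 v → u ≡ v
  ∈-ball-zero⁻ = singleton⁻

  private
    joins? : ∀ t u → Dec (T (elem u (ball G t v) ∨ any (λ w → adj G w u) (ball G t v)))
    joins? t u = T? _

  ∈-ball-suc⁺ : ∀ t {u} → u ∈ vertices G →
                u ∈ ball G t v ⊎ Any (λ w → T (adj G w u)) (ball G t v) → u ∈ ball G (suc t) v
  ∈-ball-suc⁺ t u∈V reach =
    ∈-filter⁺ (joins? t) u∈V (Equivalence.from T-∨ (Sum.map elem-complete (any⁺ _) reach))

  ∈-ball-suc⁻ : ∀ t {u} → u ∈ ball G (suc t) v →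
                u ∈ ball G t v ⊎ Any (λ w → T (adj G w u)) (ball G t v)
  ∈-ball-suc⁻ t u∈ =
    Sum.map (elem-sound _) (any⁻ _ _) (Equivalence.to T-∨ (proj₂ (∈-filter⁻ (joins? t) {xs = vertices G} u∈)))

  ∈-ball-step : ∀ t {u w} → u ∈ vertices G → w ∈ ball G t v → T (adj G w u) → u ∈ ball G (suc t) v
  ∈-ball-step t u∈V w∈ wu = ∈-ball-suc⁺ t u∈V (inj₂ (lose w∈ wu))

  ball-mono : ∀ {s t u} → u ∈ vertices G → s ≤ t → u ∈ ball G s v → u ∈ ball G t v
  ball-mono {u = u} u∈V = go ∘ ≤⇒≤′
    where
    go : ∀ {s t} → s ≤′ t → u ∈ ball G s v → u ∈ ball G t v
    go ≤′-refl                = id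
    go (≤′-step {n = t} s≤′t) = ∈-ball-suc⁺ t u∈V ∘ inj₁ ∘ go s≤′t

  searchDist-hit : ∀ {u t f} → u ∈ ball G t v → searchDist G v u t (suc f) ≡ t
  searchDist-hit {u} {t} hit with elem u (ball G t v) | elem-complete hit
  ... | true  | _  = refl
  ... | false | ()

  searchDist-miss : ∀ {u t f} → u ∉ ball G t v → searchDist G v u t (suc f) ≡ searchDist G v u (suc t) f
  searchDist-miss {u} {t} miss with elem u (ball G t v) | elem-sound {u} (ball G t v)
  ... | true  | sound = contradiction (sound _) miss
  ... | false | _     = refl

  dist-least : ∀ {u t} → t ≤ length (vertices G) →
               (∀ {r} → r < t → u ∉ ball G r v) → u ∈ ball G t v → dist G v u ≡ t
  dist-least {u} {t} t≤|V| miss hit = go 0 (length (vertices G)) z≤n t≤|V| (λ _ → miss)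
    where
    go : ∀ s f → s ≤ t → t ≤ s + f → (∀ {r} → s ≤ r → r < t → u ∉ ball G r v) →
         searchDist G v u s f ≡ t
    go s f s≤t t≤s+f missFrom with m≤n⇒m<n∨m≡n s≤t
    go s zero    _ _ _ | inj₂ refl = refl
    go s (suc f) _ _ _ | inj₂ refl = searchDist-hit {t = s} hit
    go s zero    _ t≤s+0 _ | inj₁ s<t = contradiction (subst (t ≤_) (+-identityʳ s) t≤s+0) (<⇒≱ s<t)
    go s (suc f) _ t≤s+f missFrom | inj₁ s<t = begin
      searchDist G v u s (suc f)  ≡⟨ searchDist-miss {t = s} (missFrom ≤-refl s<t) ⟩
      searchDist G v u (suc s) f  ≡⟨ go (suc s) f s<t (subst (t ≤_) (+-suc s f) t≤s+f) (missFrom ∘ <⇒≤) ⟩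
      t                           ∎
      where open ≡-Reasoning

  dist-refl : dist G v v ≡ 0
  dist-refl = dist-least z≤n (λ ()) (here refl)

  dist-adjacent : ∀ {u} → u ∈ vertices G → u ≢ v → T (adj G v u) → dist G v u ≡ 1
  dist-adjacent u∈V u≢v vu = dist-least (∈-length u∈V) (λ { (s≤s z≤n) → u≢v ∘ ∈-ball-zero⁻ })
    (∈-ball-step 0 u∈V (here refl) vu)

  dist-two : ∀ {u w} → 2 ≤ length (vertices G) → u ∈ vertices G → u ≢ v → ¬ T (adj G v u) →
             w ∈ vertices G → T (adj G v w) → T (adj G w u) → dist G v u ≡ 2
  dist-two 2≤|V| u∈V u≢v ¬vu w∈V vw wu =
    dist-least 2≤|V| miss (∈-ball-step 1 u∈V (∈-ball-step 0 w∈V (here refl) vw) wu)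
    where
    miss : ∀ {r} → r < 2 → _ ∉ ball G r v
    miss (s≤s z≤n)       = u≢v ∘ ∈-ball-zero⁻
    miss (s≤s (s≤s z≤n)) = [ u≢v ∘ ∈-ball-zero⁻ , ¬vu ∘ singleton⁻ ] ∘ ∈-ball-suc⁻ 0

  ecc-attained : ∀ {u e} → All (λ x → dist G v x ≤ e) (vertices G) → u ∈ vertices G →
                 dist G v u ≡ e → ecc G v ≡ e
  ecc-attained dist≤e u∈V refl =
    ≤-antisym (foldr-⊔-lub (dist G v) (vertices G) dist≤e) (foldr-⊔-upper (dist G v) u∈V)

record IsStar (G : Graph) (c : ℕ) (L : List ℕ) : Set where
  field
    vertices≡          : vertices G ≡ c ∷ L
    unique             : Unique (c ∷ L)
    centre-leaf        : ∀ {u} → u ∈ L → T (adj G c u)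
    leaf-centre        : ∀ {u} → u ∈ L → T (adj G u c)
    centre-loopless    : ¬ T (adj G c c)
    leaves-independent : ∀ {u w} → u ∈ L → w ∈ L → ¬ T (adj G u w)

module _ {G : Graph} {c : ℕ} {L : List ℕ} (star : IsStar G c L) where
  open IsStar star

  private
    ∈V : ∀ {x} → x ∈ c ∷ L → x ∈ vertices G
    ∈V {x} = subst (x ∈_) (sym vertices≡)

    length-vertices : length (vertices G) ≡ suc (length L)
    length-vertices = cong length vertices≡

    leaf≢centre : ∀ {u} → u ∈ L → u ≢ c
    leaf≢centre u∈ = All.lookup (AllPairs.head unique) u∈ ∘ sym

  star-degree-centre : degree G c ≡ length L
  star-degree-centre = begin
    length (filter P? (vertices G))  ≡⟨ cong (length ∘ filter P?) vertices≡ ⟩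
    length (filter P? (c ∷ L))       ≡⟨ cong length (filter-reject P? centre-loopless) ⟩
    length (filter P? L)             ≡⟨ cong length (filter-all P? (All.tabulate centre-leaf)) ⟩
    length L                         ∎
    where
    open ≡-Reasoning
    P? : ∀ u → Dec (T (adj G c u))
    P? u = T? (adj G c u)

  star-degree-leaf : ∀ {v} → v ∈ L → degree G v ≡ 1
  star-degree-leaf {v} v∈ = begin
    length (filter P? (vertices G))  ≡⟨ cong (length ∘ filter P?) vertices≡ ⟩
    length (filter P? (c ∷ L))       ≡⟨ cong length (filter-accept P? (leaf-centre v∈)) ⟩
    suc (length (filter P? L))       ≡⟨ cong (suc ∘ length) (filter-none P? (All.tabulate (leaves-independent v∈))) ⟩
    1                                ∎
    where
    open ≡-Reasoning
    P? : ∀ u → Dec (T (adj G v u))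
    P? u = T? (adj G v u)

  star-dist-centre-leaf : ∀ {u} → u ∈ L → dist G c u ≡ 1
  star-dist-centre-leaf u∈ = dist-adjacent (∈V (there u∈)) (leaf≢centre u∈) (centre-leaf u∈)

  star-dist-leaf-centre : ∀ {v} → v ∈ L → dist G v c ≡ 1
  star-dist-leaf-centre v∈ = dist-adjacent (∈V (here refl)) (leaf≢centre v∈ ∘ sym) (leaf-centre v∈)

  star-dist-leaf-leaf : ∀ {v u} → v ∈ L → u ∈ L → u ≢ v → dist G v u ≡ 2
  star-dist-leaf-leaf v∈ u∈ u≢v =
    dist-two (subst (2 ≤_) (sym length-vertices) (s≤s (∈-length v∈)))
      (∈V (there u∈)) u≢v (leaves-independent v∈ u∈) (∈V (here refl)) (leaf-centre v∈) (centre-leaf u∈)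

  star-ecc : ∀ {v u e} → All (λ x → dist G v x ≤ e) (c ∷ L) → u ∈ c ∷ L → dist G v u ≡ e → ecc G v ≡ e
  star-ecc dist≤e u∈ = ecc-attained (subst (All _) (sym vertices≡) dist≤e) (∈V u∈)

  star-ecc-centre : ∀ {u} → u ∈ L → ecc G c ≡ 1
  star-ecc-centre u∈ =
    star-ecc (≤-trans (≤-reflexive (dist-refl {G})) z≤n ∷ All.tabulate (≤-reflexive ∘ star-dist-centre-leaf))
      (there u∈) (star-dist-centre-leaf u∈)

  star-ecc-leaf : ∀ {v u} → v ∈ L → u ∈ L → u ≢ v → ecc G v ≡ 2
  star-ecc-leaf {v} v∈ u∈ u≢v =
    star-ecc (≤-trans (≤-reflexive (star-dist-leaf-centre v∈)) (s≤s z≤n) ∷ All.tabulate dist≤2)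
      (there u∈) (star-dist-leaf-leaf v∈ u∈ u≢v)
    where
    dist≤2 : ∀ {x} → x ∈ L → dist G v x ≤ 2
    dist≤2 {x} x∈ with x ≟ v
    ... | yes refl = ≤-trans (≤-reflexive (dist-refl {G})) z≤n
    ... | no x≢v   = ≤-reflexive (star-dist-leaf-leaf v∈ x∈ x≢v)

  star-eccConn-split : eccConn G ≡ degree G c * ecc G c + sum (map (λ v → degree G v * ecc G v) L)
  star-eccConn-split = cong (sum ∘ map (λ v → degree G v * ecc G v)) vertices≡

  star-eccConn : 2 ≤ length L → eccConn G ≡ 3 * length L
  star-eccConn 2≤|L| = begin
    eccConn G                                                       ≡⟨ star-eccConn-split ⟩
    degree G c * ecc G c + sum (map (λ v → degree G v * ecc G v) L) ≡⟨ cong₂ _+_ centre leaves ⟩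
    length L * 1 + length L * 2                                     ≡⟨ cong₂ _+_ (*-identityʳ (length L)) (*-comm (length L) 2) ⟩
    3 * length L                                                    ∎
    where
    open ≡-Reasoning
    other : ∀ x → ∃[ y ] y ∈ L × y ≢ x
    other = ∃-other-member (AllPairs.tail unique) 2≤|L|

    centre : degree G c * ecc G c ≡ length L * 1
    centre = let _ , u∈ , _ = other c in cong₂ _*_ star-degree-centre (star-ecc-centre u∈)

    leaves : sum (map (λ v → degree G v * ecc G v) L) ≡ length L * 2
    leaves = sum-map-const _ L (All.tabulate λ {v} v∈ →
      let _ , u∈ , u≢v = other v in cong₂ _*_ (star-degree-leaf v∈) (star-ecc-leaf v∈ u∈ u≢v))

  star-connected : 1 ≤ length L → Connected G
  star-connected 1≤|L| = All.tabulate λ v∈V → All.tabulate λ u∈V →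
    elem-complete (ball-mono {G} u∈V 2≤|V| (within-two (∈cL v∈V) (∈cL u∈V)))
    where
    ∈cL : ∀ {x} → x ∈ vertices G → x ∈ c ∷ L
    ∈cL {x} = subst (x ∈_) vertices≡

    2≤|V| : 2 ≤ length (vertices G)
    2≤|V| = subst (2 ≤_) (sym length-vertices) (s≤s 1≤|L|)

    centre-within-one : ∀ {v} → v ∈ c ∷ L → c ∈ ball G 1 v
    centre-within-one (here refl) = ∈-ball-suc⁺ {G} 0 (∈V (here refl)) (inj₁ (here refl))
    centre-within-one (there v∈)  = ∈-ball-step {G} 0 (∈V (here refl)) (here refl) (leaf-centre v∈)

    within-two : ∀ {v u} → v ∈ c ∷ L → u ∈ c ∷ L → u ∈ ball G 2 v
    within-two v∈ (here refl) = ∈-ball-suc⁺ {G} 1 (∈V (here refl)) (inj₁ (centre-within-one v∈))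
    within-two v∈ (there u∈)  = ∈-ball-step {G} 1 (∈V (there u∈)) (centre-within-one v∈) (centre-leaf u∈)

star-eccConn-K₂ : ∀ {G c ℓ} → IsStar G c (ℓ ∷ []) → eccConn G ≡ 2
star-eccConn-K₂ {G} {c} {ℓ} star = begin
  eccConn G                                         ≡⟨ star-eccConn-split star ⟩
  degree G c * ecc G c + (degree G ℓ * ecc G ℓ + 0) ≡⟨ cong₂ _+_ centre (cong (_+ 0) leaf) ⟩
  2                                                 ∎
  where
  open ≡-Reasoning
  ℓ∈ : ℓ ∈ ℓ ∷ []
  ℓ∈ = here refl

  centre : degree G c * ecc G c ≡ 1
  centre = cong₂ _*_ (star-degree-centre star) (star-ecc-centre star ℓ∈)

  leaf : degree G ℓ * ecc G ℓ ≡ 1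
  leaf = cong₂ _*_ (star-degree-leaf star ℓ∈) (star-ecc star dist≤1 (here refl) (star-dist-leaf-centre star ℓ∈))
    where
    dist≤1 : All (λ x → dist G ℓ x ≤ 1) (c ∷ ℓ ∷ [])
    dist≤1 = ≤-reflexive (star-dist-leaf-centre star ℓ∈) ∷ ≤-trans (≤-reflexive (dist-refl {G})) z≤n ∷ []

∈-divisors⁺ : ∀ {n d} .{{_ : NonZero n}} → d ∣ n → d ∈ divisors n
∈-divisors⁺ {n} {zero}  d∣n = contradiction (0∣⇒≡0 d∣n) (≢-nonZero⁻¹ n)
∈-divisors⁺ {n} {suc d} d∣n = ∈-filter⁺ (_∣? n) (∈-map⁺ suc (∈-upTo⁺ (∣⇒≤ d∣n))) d∣n

∈-divisors⁻ : ∀ {n d} → d ∈ divisors n → d ∣ n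
∈-divisors⁻ {n} d∈ = proj₂ (∈-filter⁻ (_∣? n) {xs = map suc (upTo n)} d∈)

divisors-increasing : ∀ n → AllPairs _<_ (divisors n)
divisors-increasing n =
  AllPairsₚ.filter⁺ (_∣? n) (AllPairsₚ.map⁺ (AllPairsₚ.applyUpTo⁺₁ id n (λ i<j _ → s≤s i<j)))

divisorPrimeGraph-adj⁺ : ∀ n {x y} → x ≢ y → Coprime x y → T (adj (divisorPrimeGraph n) x y)
divisorPrimeGraph-adj⁺ _ {x} {y} x≢y coprime =
  Equivalence.from (T-∧ {not ⌊ x ≟ y ⌋})
    (fromWitnessFalse {a? = x ≟ y} x≢y , fromWitness {a? = gcd x y ≟ 1} (coprime⇒gcd≡1 coprime))

divisorPrimeGraph-adj⁻ : ∀ n {x y} → T (adj (divisorPrimeGraph n) x y) → x ≢ y × Coprime x y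
divisorPrimeGraph-adj⁻ _ {x} {y} xy =
  let x≢y , gcd≡1 = Equivalence.to (T-∧ {not ⌊ x ≟ y ⌋}) xy
  in toWitnessFalse {a? = x ≟ y} x≢y , gcd≡1⇒coprime (toWitness {a? = gcd x y ≟ 1} gcd≡1)

^-monoʳ-∣ : ∀ m {i j} → i ≤ j → m ^ i ∣ m ^ j
^-monoʳ-∣ m {j = j} z≤n = 1∣ (m ^ j)
^-monoʳ-∣ m (s≤s i≤j)   = *-monoʳ-∣ m (^-monoʳ-∣ m i≤j)

module _ {p : ℕ} (prime[p] : Prime p) where

  private
    instance
      p≢0 : NonZero p
      p≢0 = prime⇒nonZero prime[p]

    1<p : 1 < p
    1<p = nonTrivial⇒n>1 p {{prime⇒nonTrivial prime[p]}}

  prime-∤⇒coprime : ∀ {n} → ¬ p ∣ n → Coprime p n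
  prime-∤⇒coprime p∤n (d∣p , d∣n) with prime⇒irreducible prime[p] d∣p
  ... | inj₁ d≡1    = d≡1
  ... | inj₂ refl   = contradiction d∣n p∤n

  ∣prime^⇒≡prime^ : ∀ k {d} → d ∣ p ^ k → ∃[ i ] i ≤ k × d ≡ p ^ i
  ∣prime^⇒≡prime^ zero    d∣1 = 0 , z≤n , ∣1⇒≡1 d∣1
  ∣prime^⇒≡prime^ (suc k) {d} d∣p^[1+k] with p ∣? d
  ... | yes (divides q refl) =
    let i , i≤k , q≡p^i = ∣prime^⇒≡prime^ k (*-cancelʳ-∣ {m = q} p (subst (q * p ∣_) (*-comm p (p ^ k)) d∣p^[1+k]))
    in suc i , s≤s i≤k , trans (cong (_* p) q≡p^i) (*-comm (p ^ i) p)
  ... | no p∤d =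
    let i , i≤k , d≡p^i = ∣prime^⇒≡prime^ k (coprime-divisor (Coprimality.sym (prime-∤⇒coprime p∤d)) d∣p^[1+k])
    in i , m≤n⇒m≤1+n i≤k , d≡p^i

  powers-increasing : ∀ n → AllPairs _<_ (applyUpTo (p ^_) n)
  powers-increasing n = AllPairsₚ.applyUpTo⁺₁ (p ^_) n (λ i<j _ → ^-monoʳ-< p 1<p i<j)

  divisors-prime^ : ∀ k → divisors (p ^ k) ≡ applyUpTo (p ^_) (suc k)
  divisors-prime^ k =
    strictlyIncreasing-≡ (divisors-increasing (p ^ k)) (powers-increasing (suc k))
      divisors⊆powers powers⊆divisors
    where
    instance
      p^k≢0 : NonZero (p ^ k)
      p^k≢0 = m^n≢0 p k

    divisors⊆powers : divisors (p ^ k) ⊆ applyUpTo (p ^_) (suc k)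
    divisors⊆powers d∈ with i , i≤k , refl ← ∣prime^⇒≡prime^ k (∈-divisors⁻ d∈) =
      ∈-applyUpTo⁺ (p ^_) (s≤s i≤k)

    powers⊆divisors : applyUpTo (p ^_) (suc k) ⊆ divisors (p ^ k)
    powers⊆divisors d∈ with i , s≤s i≤k , refl ← ∈-applyUpTo⁻ (p ^_) d∈ =
      ∈-divisors⁺ (^-monoʳ-∣ p i≤k)

  divisorPrimeGraph-prime^-isStar : ∀ k → IsStar (divisorPrimeGraph (p ^ k)) 1 (applyUpTo (λ i → p ^ suc i) k)
  divisorPrimeGraph-prime^-isStar k = record
    { vertices≡          = divisors-prime^ k
    ; unique             = AllPairs.map <⇒≢ (powers-increasing (suc k))
    ; centre-leaf        = λ u∈ → divisorPrimeGraph-adj⁺ (p ^ k) (leaf≢1 u∈ ∘ sym) (1-coprimeTo _)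
    ; leaf-centre        = λ u∈ → divisorPrimeGraph-adj⁺ (p ^ k) (leaf≢1 u∈) (Coprimality.sym (1-coprimeTo _))
    ; centre-loopless    = λ loop → proj₁ (divisorPrimeGraph-adj⁻ (p ^ k) {1} loop) refl
    ; leaves-independent = λ u∈ w∈ uw → p≢1 (proj₂ (divisorPrimeGraph-adj⁻ (p ^ k) uw) (p∣leaf u∈ , p∣leaf w∈))
    }
    where
    p≢1 : p ≢ 1
    p≢1 refl = ¬prime[1] prime[p]

    p∣leaf : ∀ {u} → u ∈ applyUpTo (λ i → p ^ suc i) k → p ∣ u
    p∣leaf u∈ with i , _ , refl ← ∈-applyUpTo⁻ (λ i → p ^ suc i) u∈ = m∣m*n (p ^ i)

    leaf≢1 : ∀ {u} → u ∈ applyUpTo (λ i → p ^ suc i) k → u ≢ 1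
    leaf≢1 u∈ refl = p≢1 (∣1⇒≡1 (p∣leaf u∈))

corollary3p8 : (p k : ℕ) → Prime p → k ≥ 1 →
    Connected (divisorPrimeGraph (p ^ k)) ×
    ((k ≥ 2 → eccConn (divisorPrimeGraph (p ^ k)) ≡ 3 * k) ×
     (k ≡ 1 → eccConn (divisorPrimeGraph (p ^ k)) ≡ 2))
corollary3p8 p k prime[p] k≥1 =
  star-connected star (subst (1 ≤_) (sym |L|≡k) k≥1) ,
  (λ k≥2 → trans (star-eccConn star (subst (2 ≤_) (sym |L|≡k) k≥2)) (cong (3 *_) |L|≡k)) ,
  λ { refl → star-eccConn-K₂ star }
  where
  star : IsStar (divisorPrimeGraph (p ^ k)) 1 (applyUpTo (λ i → p ^ suc i) k)
  star = divisorPrimeGraph-prime^-isStar prime[p] k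

  |L|≡k : length (applyUpTo (λ i → p ^ suc i) k) ≡ k
  |L|≡k = length-applyUpTo (λ i → p ^ suc i) k
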